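{- Let $d>6$ and let $G$ be a finite simple $d$-regular graph such that $G^2$ is not complete. If $R$ is a C region and $R$ contains a vertex $v$ with $\deg_2(v)=2$ and $N_2'(v)=\{u\}$, then $R$ contains at least two vertices adjacent to $u$.
   Context: $N_i(x)$ is the set of vertices at distance exactly $i$ from $x$, $N(x)=N_1(x)$, $\deg_2(x)=|N_2(x)|$; $N_2'(x)$ is the set of vertices of $N_2(x)$ adjacent to some vertex of $N_3(x)$. Let $X=\{x:\deg_2(x)<4\}$; $u\sim w$ on $X$ iff there is a sequence of vertices of $X$ from $u$ to $w$ with consecutive vertices at distance at most 2. A region is an equivalence class of $\sim$ together with all neighbors of its vertices. A C region is a region $R$ such that no vertex of $R$ has $\deg_2=1$ and some vertex $v'\in R$ satisfies $\deg_2(v')=2$ and $|N_2'(v')|=1$. -}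

module Defs where

open import Level using (0ℓ)
open import Data.Nat using (ℕ; zero; suc; _<_; _≤_)
open import Data.Fin using (Fin)
open import Data.List using (List; length)
open import Data.List.Membership.Propositional using (_∈_)
open import Data.List.Relation.Unary.Unique.Propositional using (Unique)
open import Data.Product using (Σ; ∃; _×_; _,_)
open import Data.Sum using (_⊎_)
open import Function.Bundles using (_⇔_)
open import Relation.Nullary using (¬_; Dec)
open import Relation.Binary.PropositionalEquality using (_≡_; _≢_)

record SimpleGraph (n : ℕ) : Set₁ where
  field
    Adj     : Fin n → Fin n → Set
    adj?    : ∀ x y → Dec (Adj x y)
    sym     : ∀ {x y} → Adj x y → Adj y x
    irrefl  : ∀ {x} → ¬ Adj x x

module _ {n : ℕ} (G : SimpleGraph n) where
  open SimpleGraph G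

  data Walk : Fin n → Fin n → ℕ → Set where
    nil  : ∀ {x} → Walk x x 0
    cons : ∀ {x y z k} → Adj x y → Walk y z k → Walk x z (suc k)

  Dist : Fin n → Fin n → ℕ → Set
  Dist x y i = Walk x y i × (∀ j → j < i → ¬ Walk x y j)

  N : ℕ → Fin n → Fin n → Set
  N i x y = Dist x y i

  HasCard : (Fin n → Set) → ℕ → Set
  HasCard P m = Σ (List (Fin n)) λ l →
    Unique l × (∀ y → (y ∈ l) ⇔ P y) × length l ≡ m

  Deg2 : Fin n → ℕ → Set
  Deg2 x m = HasCard (N 2 x) m

  Regular : ℕ → Set
  Regular d = ∀ x → HasCard (Adj x) d

  SquareComplete : Set
  SquareComplete = ∀ x y → x ≢ y → ∃ λ i → i ≤ 2 × Dist x y i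

  N2' : Fin n → Fin n → Set
  N2' x y = N 2 x y × ∃ λ z → N 3 x z × Adj y z

  InX : Fin n → Set
  InX x = ∃ λ m → Deg2 x m × m < 4

  data _∼_ : Fin n → Fin n → Set where
    here : ∀ {u} → InX u → u ∼ u
    step : ∀ {u v w} → InX u → (∃ λ i → i ≤ 2 × Dist u v i) → v ∼ w → u ∼ w

  InRegion : Fin n → Fin n → Set
  InRegion r v = r ∼ v ⊎ ∃ λ w → r ∼ w × Adj w v

  IsCRegion : Fin n → Set
  IsCRegion r =
    (∀ v → InRegion r v → ¬ Deg2 v 1) ×
    ∃ λ v' → InRegion r v' × Deg2 v' 2 × HasCard (N2' v') 1

-- Let w be a common neighbour of v and u. A second common neighbour would finish
-- the proof, both being neighbours of v ∈ X; so assume w is the only one. Then the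
-- 2-ball of every neighbour x ≠ w of v lies in the 2-ball of v, and comparing their
-- sizes 1 + d + deg₂ in the d-regular graph gives deg₂ x ≤ deg₂ v = 2, so x ∈ X.
-- If some y ∈ N₂(v) is adjacent to u, a neighbour x ∉ {u, w} of y (d ≥ 3) must be a
-- neighbour of v, because N₂(v) = {u, y} and y ∉ N₂'(v); so y ∈ R, next to w.
-- Otherwise take a neighbour x of v outside the closed neighbourhood of w (it exists
-- by counting): u is then in the 2-ball of v but not in that of x, which forces
-- N₂(x) = {w}, impossible in a C region.
module Submission where

open import Defs
open import Level using (0ℓ)
open import Function using (_∘_)
open import Data.Nat using (ℕ; zero; suc; _+_; _≤_; _<_; z≤n; s≤s; z<s; s<s)
open import Data.Nat.Properties
  using (≤-refl; ≤-trans; ≤-antisym; ≤-pred; m≤n⇒m≤1+n; <⇒≱; +-suc; +-cancelˡ-≤; allUpTo?)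
open import Data.Fin using (Fin)
open import Data.Fin.Properties using (_≟_; any?)
open import Data.List using (List; []; _∷_; _++_; length; filter; allFin)
open import Data.List.Properties using (length-++)
open import Data.List.Membership.Propositional using (_∈_; _∉_; find)
open import Data.List.Membership.Propositional.Properties
  using (∈-∃++; ∈-++⁺ˡ; ∈-++⁺ʳ; ∈-++⁻; ∈-filter⁺; ∈-filter⁻; ∈-allFin)
import Data.List.Membership.DecPropositional as DecMembership
open import Data.List.Relation.Binary.Subset.Propositional using (_⊆_)
open import Data.List.Relation.Unary.Any using (here; there)
open import Data.List.Relation.Unary.All as All using (All; []; _∷_; all?)
open import Data.List.Relation.Unary.All.Properties using (¬All⇒Any¬; ¬Any⇒All¬)
open import Data.List.Relation.Unary.Unique.Propositional using (Unique; []; _∷_)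
open import Data.List.Relation.Unary.Unique.Propositional.Properties using (filter⁺; allFin⁺; ++⁺)
open import Data.Product using (∃; _×_; _,_; proj₁; proj₂)
open import Data.Sum using (_⊎_; inj₁; inj₂)
open import Data.Empty using (⊥-elim)
open import Function.Bundles using (_⇔_; mk⇔; Equivalence)
open import Relation.Nullary using (¬_; Dec; yes; no; contradiction)
open import Relation.Nullary.Decidable using (_×-dec_; ¬?; map′; decidable-stable)
open import Relation.Unary using (Pred; Decidable)
open import Relation.Binary.Definitions using (DecidableEquality)
open import Relation.Binary.PropositionalEquality
  using (_≡_; _≢_; refl; sym; trans; subst; subst₂; cong)

module _ {a} {A : Set a} where

  length-≤-of-⊆ : {xs ys : List A} → Unique xs → xs ⊆ ys → length xs ≤ length ys
  length-≤-of-⊆ [] _ = z≤n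
  length-≤-of-⊆ {x ∷ xs} (x∉xs ∷ !xs) xs⊆ys with ∈-∃++ (xs⊆ys (here refl))
  ... | pre , post , refl = begin
    suc (length xs)                ≤⟨ s≤s (length-≤-of-⊆ !xs xs⊆pre++post) ⟩
    suc (length (pre ++ post))     ≡⟨ cong suc (length-++ pre) ⟩
    suc (length pre + length post) ≡⟨ +-suc (length pre) (length post) ⟨
    length pre + length (x ∷ post) ≡⟨ length-++ pre ⟨
    length (pre ++ x ∷ post)       ∎
    where
    open Data.Nat.Properties.≤-Reasoning
    xs⊆pre++post : xs ⊆ pre ++ post
    xs⊆pre++post y∈xs with ∈-++⁻ pre (xs⊆ys (there y∈xs))
    ... | inj₁ y∈pre = ∈-++⁺ˡ y∈pre
    ... | inj₂ (here refl) = ⊥-elim (All.lookup x∉xs y∈xs refl)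
    ... | inj₂ (there y∈post) = ∈-++⁺ʳ pre y∈post

  module _ (_≟ᴬ_ : DecidableEquality A) where
    open DecMembership _≟ᴬ_ using (_∈?_)

    ∃-∉-of-length-< : {xs ys : List A} → Unique ys → length xs < length ys →
                      ∃ λ y → y ∈ ys × y ∉ xs
    ∃-∉-of-length-< {xs} {ys} !ys xs<ys with all? (_∈? xs) ys
    ... | yes ys⊆xs = contradiction (length-≤-of-⊆ !ys (All.lookup ys⊆xs)) (<⇒≱ xs<ys)
    ... | no ys⊈xs  = find (¬All⇒Any¬ (_∈? xs) ys ys⊈xs)

∃≢⊎∀≡ : ∀ {n p} {P : Pred (Fin n) p} → Decidable P → ∀ w →
        (∃ λ z → P z × z ≢ w) ⊎ (∀ {z} → P z → z ≡ w)
∃≢⊎∀≡ P? w with any? (λ z → P? z ×-dec ¬? (z ≟ w))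
... | yes another = inj₁ another
... | no noOther = inj₂ λ {z} Pz → decidable-stable (z ≟ w) (λ z≢w → noOther (z , Pz , z≢w))

module _ {n : ℕ} (G : SimpleGraph n) where
  open SimpleGraph G renaming (sym to Adj-sym)
  open DecMembership (_≟_ {n}) using (_∈?_)

  private variable
    P : Pred (Fin n) 0ℓ
    i m k : ℕ
    u w x y z : Fin n

  length-≤-of-HasCard : HasCard G P m → {xs : List (Fin n)} → Unique xs →
                        (∀ {y} → y ∈ xs → P y) → length xs ≤ m
  length-≤-of-HasCard (_ , _ , l⇔P , refl) !xs xs⊆P =
    length-≤-of-⊆ !xs (λ y∈xs → Equivalence.from (l⇔P _) (xs⊆P y∈xs))

  HasCard-unique : HasCard G P m → HasCard G P k → m ≡ k
  HasCard-unique Pm@(_ , !l , l⇔P , refl) Pk@(_ , !l′ , l′⇔P , refl) = ≤-antisym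
    (length-≤-of-HasCard Pk !l (Equivalence.to (l⇔P _)))
    (length-≤-of-HasCard Pm !l′ (Equivalence.to (l′⇔P _)))

  HasCard-filter : (P? : Decidable P) → HasCard G P (length (filter P? (allFin n)))
  HasCard-filter P? = filter P? (allFin n) , filter⁺ P? (allFin⁺ n) ,
    (λ y → mk⇔ (λ y∈ → proj₂ (∈-filter⁻ P? {xs = allFin n} y∈)) (∈-filter⁺ P? (∈-allFin y))) , refl

  HasCard-2-cover : HasCard G P 2 → P x → P y → x ≢ y → P z → z ≡ x ⊎ z ≡ y
  HasCard-2-cover {P = P} {x = x} {y = y} {z = z} P2 Px Py x≢y Pz with z ≟ x | z ≟ y
  ... | yes z≡x | _ = inj₁ z≡x
  ... | no _ | yes z≡y = inj₂ z≡y
  ... | no z≢x | no z≢y = contradiction (length-≤-of-HasCard P2 !xyz xyz⊆P) (<⇒≱ ≤-refl)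
    where
    !xyz : Unique (x ∷ y ∷ z ∷ [])
    !xyz = (x≢y ∷ (z≢x ∘ sym) ∷ []) ∷ ((z≢y ∘ sym) ∷ []) ∷ [] ∷ []
    xyz⊆P : ∀ {t} → t ∈ x ∷ y ∷ z ∷ [] → P t
    xyz⊆P (here refl) = Px
    xyz⊆P (there (here refl)) = Py
    xyz⊆P (there (there (here refl))) = Pz

  walk? : ∀ x y k → Dec (Walk G x y k)
  walk? x y zero = map′ (λ { refl → nil }) (λ { nil → refl }) (x ≟ y)
  walk? x y (suc k) = map′ (λ (_ , xz , zy) → cons xz zy) (λ { (cons xz zy) → _ , xz , zy })
    (any? λ z → adj? x z ×-dec walk? z y k)

  dist? : ∀ x y i → Dec (Dist G x y i)
  dist? x y i = walk? x y i ×-dec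
    map′ (λ noShorter j → noShorter {j}) (λ noShorter {j} → noShorter j)
         (allUpTo? (λ j → ¬? (walk? x y j)) i)

  walk-snoc : Walk G x y k → Adj y z → Walk G x z (suc k)
  walk-snoc nil yz = cons yz nil
  walk-snoc (cons xw wy) yz = cons xw (walk-snoc wy yz)

  neighbours : Fin n → List (Fin n)
  neighbours x = filter (adj? x) (allFin n)

  closedNbhd : Fin n → List (Fin n)
  closedNbhd x = x ∷ neighbours x

  sphere₂ : Fin n → List (Fin n)
  sphere₂ x = filter (λ y → dist? x y 2) (allFin n)

  ball₂ : Fin n → List (Fin n)
  ball₂ x = closedNbhd x ++ sphere₂ x

  deg₂ : Fin n → ℕ
  deg₂ x = length (sphere₂ x)

  deg₂-HasCard : ∀ x → Deg2 G x (deg₂ x)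
  deg₂-HasCard x = HasCard-filter (λ y → dist? x y 2)

  ∈-neighbours⁺ : Adj x y → y ∈ neighbours x
  ∈-neighbours⁺ {x} {y} = ∈-filter⁺ (adj? x) (∈-allFin y)

  ∈-neighbours⁻ : y ∈ neighbours x → Adj x y
  ∈-neighbours⁻ {x = x} y∈ = proj₂ (∈-filter⁻ (adj? x) {xs = allFin n} y∈)

  ∈-sphere₂⁺ : N G 2 x y → y ∈ sphere₂ x
  ∈-sphere₂⁺ {x} {y} = ∈-filter⁺ (λ y → dist? x y 2) (∈-allFin y)

  ∈-sphere₂⁻ : y ∈ sphere₂ x → N G 2 x y
  ∈-sphere₂⁻ {x = x} y∈ = proj₂ (∈-filter⁻ (λ y → dist? x y 2) {xs = allFin n} y∈)

  Adj⇒N₁ : Adj x y → N G 1 x y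
  Adj⇒N₁ xy = cons xy nil , λ { zero _ nil → irrefl xy ; (suc _) (s≤s ()) }

  walk⇒∈closedNbhd : i < 2 → Walk G x y i → y ∈ closedNbhd x
  walk⇒∈closedNbhd _ nil = here refl
  walk⇒∈closedNbhd _ (cons xy nil) = there (∈-neighbours⁺ xy)
  walk⇒∈closedNbhd (s≤s (s≤s ())) (cons _ (cons _ _))

  N₂-intro : y ∉ closedNbhd x → Walk G x y 2 → N G 2 x y
  N₂-intro y∉ xy = xy , λ j j<2 xy′ → y∉ (walk⇒∈closedNbhd j<2 xy′)

  N₂⇒∉closedNbhd : N G 2 x y → y ∉ closedNbhd x
  N₂⇒∉closedNbhd (_ , noShorter) (here refl) = noShorter 0 (s≤s z≤n) nil
  N₂⇒∉closedNbhd (_ , noShorter) (there y∈) =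
    noShorter 1 (s≤s (s≤s z≤n)) (cons (∈-neighbours⁻ y∈) nil)

  ∈-closedNbhd-sym : y ∈ closedNbhd x → x ∈ closedNbhd y
  ∈-closedNbhd-sym (here refl) = here refl
  ∈-closedNbhd-sym (there y∈) = there (∈-neighbours⁺ (Adj-sym (∈-neighbours⁻ y∈)))

  closedNbhd⊆ball₂ : closedNbhd x ⊆ ball₂ x
  closedNbhd⊆ball₂ = ∈-++⁺ˡ

  walk⇒∈ball₂ : i < 3 → Walk G x y i → y ∈ ball₂ x
  walk⇒∈ball₂ _ nil = closedNbhd⊆ball₂ (here refl)
  walk⇒∈ball₂ _ (cons xy nil) = closedNbhd⊆ball₂ (there (∈-neighbours⁺ xy))
  walk⇒∈ball₂ {x = x} {y = y} _ xy@(cons _ (cons _ nil)) with y ∈? closedNbhd x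
  ... | yes y∈ = closedNbhd⊆ball₂ y∈
  ... | no y∉ = ∈-++⁺ʳ (closedNbhd x) (∈-sphere₂⁺ (N₂-intro y∉ xy))
  walk⇒∈ball₂ (s≤s (s≤s (s≤s ()))) (cons _ (cons _ (cons _ _)))

  N₃-intro : y ∉ ball₂ x → Walk G x y 3 → N G 3 x y
  N₃-intro y∉ xy = xy , λ j j<3 xy′ → y∉ (walk⇒∈ball₂ j<3 xy′)

  ∈-ball₂⁻ : y ∈ ball₂ x → x ≡ y ⊎ Adj x y ⊎ N G 2 x y
  ∈-ball₂⁻ {x = x} y∈ with ∈-++⁻ (closedNbhd x) y∈
  ... | inj₁ (here refl) = inj₁ refl
  ... | inj₁ (there y∈nbrs) = inj₂ (inj₁ (∈-neighbours⁻ y∈nbrs))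
  ... | inj₂ y∈sphere = inj₂ (inj₂ (∈-sphere₂⁻ y∈sphere))

  closedNbhd-unique : ∀ x → Unique (closedNbhd x)
  closedNbhd-unique x =
    ¬Any⇒All¬ (neighbours x) (irrefl ∘ ∈-neighbours⁻) ∷ filter⁺ (adj? x) (allFin⁺ n)

  ball₂-unique : ∀ x → Unique (ball₂ x)
  ball₂-unique x = ++⁺ (closedNbhd-unique x) (filter⁺ (λ y → dist? x y 2) (allFin⁺ n))
    (λ (y∈nbhd , y∈sphere) → N₂⇒∉closedNbhd (∈-sphere₂⁻ y∈sphere) y∈nbhd)

  N₂-neighbour-∈ball₂ : N G 2 x y → ¬ N2' G x y → Adj y z → z ∈ ball₂ x
  N₂-neighbour-∈ball₂ {x = x} {z = z} xy ¬N₂′ yz with z ∈? ball₂ x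
  ... | yes z∈ = z∈
  ... | no z∉ = contradiction (xy , z , N₃-intro z∉ (walk-snoc (proj₁ xy) yz) , yz) ¬N₂′

  ball₂-⊆-of-neighbour : Adj x y → (∀ {z} → Adj y z → ¬ N2' G x z) → ball₂ y ⊆ ball₂ x
  ball₂-⊆-of-neighbour xy avoidsN₂′ z∈ with ∈-ball₂⁻ z∈
  ... | inj₁ refl = walk⇒∈ball₂ (s<s z<s) (cons xy nil)
  ... | inj₂ (inj₁ yz) = walk⇒∈ball₂ (s<s (s<s z<s)) (cons xy (cons yz nil))
  ... | inj₂ (inj₂ (cons yt (cons tz nil) , _))
    with ∈-ball₂⁻ (walk⇒∈ball₂ (s<s (s<s z<s)) (cons xy (cons yt nil)))
  ...   | inj₁ refl = walk⇒∈ball₂ (s<s z<s) (cons tz nil)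
  ...   | inj₂ (inj₁ xt) = walk⇒∈ball₂ (s<s (s<s z<s)) (cons xt (cons tz nil))
  ...   | inj₂ (inj₂ xt) = N₂-neighbour-∈ball₂ xt (avoidsN₂′ yt) tz

  ∼-snoc : ∀ {r w} → _∼_ G r w → (∃ λ i → i ≤ 2 × Dist G w x i) → InX G x → _∼_ G r x
  ∼-snoc (here Xr) wx Xx = step Xr wx (here Xx)
  ∼-snoc (step Xr rs s∼w) wx Xx = step Xr rs (∼-snoc s∼w wx Xx)

  ∼-snoc-neighbour : ∀ {r w} → _∼_ G r w → Adj w x → InX G x → _∼_ G r x
  ∼-snoc-neighbour r∼w wx = ∼-snoc r∼w (1 , s≤s z≤n , Adj⇒N₁ wx)

  InRegion⇒∼ : ∀ {r} → InRegion G r x → InX G x → _∼_ G r x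
  InRegion⇒∼ (inj₁ r∼x) _ = r∼x
  InRegion⇒∼ (inj₂ (_ , r∼w , wx)) = ∼-snoc-neighbour r∼w wx

  TwoNeighboursInRegion : Fin n → Fin n → Set
  TwoNeighboursInRegion r u = ∃ λ a → ∃ λ b →
    a ≢ b × InRegion G r a × InRegion G r b × Adj a u × Adj b u

  module _ {d : ℕ} (reg : Regular G d) where

    length-neighbours : ∀ x → length (neighbours x) ≡ d
    length-neighbours x = HasCard-unique (HasCard-filter (adj? x)) (reg x)

    length-ball₂ : ∀ x → length (ball₂ x) ≡ suc d + deg₂ x
    length-ball₂ x =
      trans (length-++ (closedNbhd x)) (cong (λ k → suc k + deg₂ x) (length-neighbours x))

    ball₂-⊆⇒deg₂-≤ : ball₂ x ⊆ ball₂ y → deg₂ x ≤ deg₂ y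
    ball₂-⊆⇒deg₂-≤ {x = x} {y = y} x⊆y = +-cancelˡ-≤ (suc d) _ _
      (subst₂ _≤_ (length-ball₂ x) (length-ball₂ y) (length-≤-of-⊆ (ball₂-unique x) x⊆y))

    ball₂-⊂⇒deg₂-< : ball₂ x ⊆ ball₂ y → z ∈ ball₂ y → z ∉ ball₂ x → deg₂ x < deg₂ y
    ball₂-⊂⇒deg₂-< {x = x} {y = y} {z = z} x⊆y z∈y z∉x = +-cancelˡ-≤ (suc d) _ _
      (subst₂ _≤_ (trans (cong suc (length-ball₂ x)) (sym (+-suc (suc d) (deg₂ x))))
                  (length-ball₂ y)
                  (length-≤-of-⊆ (¬Any⇒All¬ (ball₂ x) z∉x ∷ ball₂-unique x) z∷x⊆y))
      where
      z∷x⊆y : z ∷ ball₂ x ⊆ ball₂ y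
      z∷x⊆y (here refl) = z∈y
      z∷x⊆y (there t∈) = x⊆y t∈

    ∃-neighbour-avoiding : 2 < d → ∀ y a b → ∃ λ x → Adj y x × x ≢ a × x ≢ b
    ∃-neighbour-avoiding 2<d y a b with ∃-∉-of-length-< _≟_ {xs = a ∷ b ∷ []}
      (filter⁺ (adj? y) (allFin⁺ n)) (subst (2 <_) (sym (length-neighbours y)) 2<d)
    ... | x , x∈ , x∉ = x , ∈-neighbours⁻ x∈ , x∉ ∘ here , x∉ ∘ there ∘ here

    ∃-neighbour-outside : Adj x w → Adj w u → u ∉ closedNbhd x → ∃ λ y → Adj x y × y ∉ closedNbhd w
    ∃-neighbour-outside {x = x} {w = w} {u = u} xw wu u∉ with ∃-∉-of-length-< _≟_
      (¬Any⇒All¬ (closedNbhd x) u∉ ∷ closedNbhd-unique x)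
      (subst₂ _<_ (cong suc (sym (length-neighbours w)))
                  (cong (suc ∘ suc) (sym (length-neighbours x))) ≤-refl)
    ... | _ , here refl , y∉ = contradiction (there (∈-neighbours⁺ wu)) y∉
    ... | _ , there (here refl) , y∉ = contradiction (there (∈-neighbours⁺ (Adj-sym xw))) y∉
    ... | y , there (there y∈) , y∉ = y , ∈-neighbours⁻ y∈ , y∉

module _ {n d : ℕ} {G : SimpleGraph n} (reg : Regular G d) {v u : Fin n}
  (deg₂v : Deg2 G v 2) (N₂′v≡u : ∀ y → N2' G v y ⇔ (y ≡ u)) where
  open SimpleGraph G renaming (sym to Adj-sym)

  private variable
    w x y : Fin n

  CommonNeighbour : Fin n → Set
  CommonNeighbour z = Adj v z × Adj z u

  deg₂v≡2 : deg₂ G v ≡ 2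
  deg₂v≡2 = HasCard-unique G (deg₂-HasCard G v) deg₂v

  u∈N₂ : N G 2 v u
  u∈N₂ = proj₁ (Equivalence.from (N₂′v≡u u) refl)

  N₂′⇒≡u : N2' G v y → y ≡ u
  N₂′⇒≡u {y} = Equivalence.to (N₂′v≡u y)

  ¬Adj-u⇒ball₂-⊆ : Adj v x → ¬ Adj x u → ball₂ G x ⊆ ball₂ G v
  ¬Adj-u⇒ball₂-⊆ {x} vx ¬xu = ball₂-⊆-of-neighbour G vx
    λ xz N₂′ → ¬xu (subst (Adj x) (N₂′⇒≡u N₂′) xz)

  ¬Adj-u⇒InX : Adj v x → ¬ Adj x u → InX G x
  ¬Adj-u⇒InX {x} vx ¬xu = deg₂ G x , deg₂-HasCard G x ,
    s≤s (m≤n⇒m≤1+n (subst (deg₂ G x ≤_) deg₂v≡2 (ball₂-⊆⇒deg₂-≤ G reg (¬Adj-u⇒ball₂-⊆ vx ¬xu))))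

  N₂-neighbour⇒neighbour : N G 2 v y → y ≢ u → Adj y x → x ≢ u → Adj v x
  N₂-neighbour⇒neighbour vy y≢u yx x≢u
    with ∈-ball₂⁻ G (N₂-neighbour-∈ball₂ G vy (y≢u ∘ N₂′⇒≡u) yx)
  ... | inj₁ refl = contradiction (there (∈-neighbours⁺ G (Adj-sym yx))) (N₂⇒∉closedNbhd G vy)
  ... | inj₂ (inj₁ vx) = vx
  ... | inj₂ (inj₂ vx) with HasCard-2-cover G deg₂v u∈N₂ vy (y≢u ∘ sym) vx
  ...   | inj₁ x≡u = contradiction x≡u x≢u
  ...   | inj₂ refl = contradiction yx irrefl

  u∉ball₂ : Adj v x → x ∉ closedNbhd G w → (∀ {z} → CommonNeighbour z → z ≡ w) →
            ¬ (∃ λ y → N G 2 v y × Adj y u) → u ∉ ball₂ G x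
  u∉ball₂ vx x∉w w-unique ¬N₂-u u∈ with ∈-ball₂⁻ G u∈
  ... | inj₁ refl = N₂⇒∉closedNbhd G u∈N₂ (there (∈-neighbours⁺ G vx))
  ... | inj₂ (inj₁ xu) = x∉w (here (w-unique (vx , xu)))
  ... | inj₂ (inj₂ (cons xz (cons zu nil) , _))
    with ∈-ball₂⁻ G (walk⇒∈ball₂ G (s<s (s<s z<s)) (cons vx (cons xz nil)))
  ...   | inj₁ refl = N₂⇒∉closedNbhd G u∈N₂ (there (∈-neighbours⁺ G zu))
  ...   | inj₂ (inj₂ vz) = ¬N₂-u (_ , vz , zu)
  ...   | inj₂ (inj₁ vz) with w-unique (vz , zu)
  ...     | refl = x∉w (there (∈-neighbours⁺ G (Adj-sym xz)))

  ∃-neighbour-of-deg₂-1 : Adj v w → Adj w u → (∀ {z} → CommonNeighbour z → z ≡ w) →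
                          ¬ (∃ λ y → N G 2 v y × Adj y u) → ∃ λ x → Adj v x × Deg2 G x 1
  ∃-neighbour-of-deg₂-1 {w} vw wu w-unique ¬N₂-u
    with ∃-neighbour-outside G reg vw wu (N₂⇒∉closedNbhd G u∈N₂)
  ... | x , vx , x∉w = x , vx , subst (Deg2 G x) deg₂x≡1 (deg₂-HasCard G x)
    where
    ¬xu : ¬ Adj x u
    ¬xu xu = x∉w (here (w-unique (vx , xu)))
    w∈N₂x : N G 2 x w
    w∈N₂x = N₂-intro G (x∉w ∘ ∈-closedNbhd-sym G) (cons (Adj-sym vx) (cons vw nil))
    deg₂x≡1 : deg₂ G x ≡ 1
    deg₂x≡1 = ≤-antisym
      (≤-pred (subst (deg₂ G x <_) deg₂v≡2 (ball₂-⊂⇒deg₂-< G reg (¬Adj-u⇒ball₂-⊆ vx ¬xu)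
        (walk⇒∈ball₂ G (s<s (s<s z<s)) (proj₁ u∈N₂)) (u∉ball₂ vx x∉w w-unique ¬N₂-u))))
      (length-≤-of-HasCard G (deg₂-HasCard G x) ([] ∷ []) λ { (here refl) → w∈N₂x })

  module _ {r : Fin n} (r∼v : _∼_ G r v) where

    neighbour-∈region : Adj v x → InRegion G r x
    neighbour-∈region vx = inj₂ (v , r∼v , vx)

    two-neighbours-of-u-via-N₂ : 2 < d → Adj v w → Adj w u →
                                 (∀ {z} → CommonNeighbour z → z ≡ w) →
                                 N G 2 v y → Adj y u → TwoNeighboursInRegion G r u
    two-neighbours-of-u-via-N₂ {w} {y} 2<d vw wu w-unique vy yu
      with ∃-neighbour-avoiding G reg 2<d y u w
    ... | x , yx , x≢u , x≢w = w , y , w≢y , neighbour-∈region vw ,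
          inj₂ (x , ∼-snoc-neighbour G r∼v vx (¬Adj-u⇒InX vx ¬xu) , Adj-sym yx) , wu , yu
      where
      vx : Adj v x
      vx = N₂-neighbour⇒neighbour vy (λ { refl → irrefl yu }) yx x≢u
      ¬xu : ¬ Adj x u
      ¬xu xu = x≢w (w-unique (vx , xu))
      w≢y : w ≢ y
      w≢y refl = N₂⇒∉closedNbhd G vy (there (∈-neighbours⁺ G vw))

    two-neighbours-of-u : 2 < d → (∀ x → InRegion G r x → ¬ Deg2 G x 1) →
                          TwoNeighboursInRegion G r u
    two-neighbours-of-u 2<d noDeg₂One with u∈N₂
    ... | cons {y = w} vw (cons wu nil) , _ with ∃≢⊎∀≡ (λ z → adj? v z ×-dec adj? z u) w
    ...   | inj₁ (w′ , (vw′ , w′u) , w′≢w) =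
      w , w′ , w′≢w ∘ sym , neighbour-∈region vw , neighbour-∈region vw′ , wu , w′u
    ...   | inj₂ w-unique with any? (λ y → dist? G v y 2 ×-dec adj? y u)
    ...     | yes (y , vy , yu) = two-neighbours-of-u-via-N₂ 2<d vw wu w-unique vy yu
    ...     | no ¬N₂-u with ∃-neighbour-of-deg₂-1 vw wu w-unique ¬N₂-u
    ...       | x , vx , deg₂x = ⊥-elim (noDeg₂One x (neighbour-∈region vx) deg₂x)

lemma4p6 : (n d : ℕ) (G : SimpleGraph n) → 6 < d → Regular G d →
    ¬ SquareComplete G →
    (r : Fin n) → InX G r → IsCRegion G r →
    (v u : Fin n) → InRegion G r v → Deg2 G v 2 →
    (∀ y → N2' G v y ⇔ (y ≡ u)) →
    ∃ λ a → ∃ λ b → a ≢ b × InRegion G r a × InRegion G r b ×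
      SimpleGraph.Adj G a u × SimpleGraph.Adj G b u
lemma4p6 n d G 6<d reg _ r _ (noDeg₂One , _) v u vR deg₂v N₂′v≡u =
  two-neighbours-of-u reg deg₂v N₂′v≡u (InRegion⇒∼ G vR (2 , deg₂v , s<s (s<s z<s)))
    (≤-trans (s≤s (s≤s (s≤s z≤n))) 6<d) noDeg₂One
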